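{- Let $G(\mathbb{V})$ be the non-zero component graph of a vector space $\mathbb{V}$ of dimension $n\ge 3$ over the field with $2$ elements. Then $\mathrm{Dist}(G(\mathbb{V}))=2$.
   Context: The non-zero component graph $G(\mathbb{V})$ of a finite-dimensional vector space $\mathbb{V}$ with a fixed basis $\{b_1,\dots,b_n\}$ has as vertex set the non-zero vectors of $\mathbb{V}$, two distinct vertices being adjacent if and only if there is some $b_i$ having non-zero coefficient in the expansions of both vectors with respect to the basis. A labeling $f:V(G)\to\{1,\dots,t\}$ of a graph $G$ is $t$-distinguishing if no non-trivial automorphism $g$ of $G$ preserves the labels (i.e., $f\circ g=f$ implies $g=\mathrm{id}$). The distinguishing number $\mathrm{Dist}(G)$ is the least $t$ such that $G$ has a $t$-distinguishing labeling. -}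

module Defs where

open import Data.Nat using (ℕ; _≤_)
open import Data.Bool using (Bool; true; false; T; _∨_; _∧_)
open import Data.Vec using (Vec; []; _∷_)
open import Data.Fin using (Fin)
open import Data.Product using (Σ; ∃; ∃-syntax; _×_; _,_; proj₁)
open import Relation.Nullary using (¬_)
open import Relation.Binary.PropositionalEquality using (_≡_)
open import Function.Bundles using (_↔_; Inverse)

record Graph : Set₁ where
  field
    Vertex : Set
    Adj    : Vertex → Vertex → Set

record Automorphism (G : Graph) : Set where
  open Graph G
  field
    perm     : Vertex ↔ Vertex
  open Inverse perm public using (to; from)
  field
    adj-pres : ∀ u v → Adj u v → Adj (to u) (to v)
    adj-refl : ∀ u v → Adj (to u) (to v) → Adj u v

IsTrivial : {G : Graph} → Automorphism G → Set
IsTrivial {G} g = ∀ v → Automorphism.to g v ≡ v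

IsDistinguishing : (G : Graph) (t : ℕ) → (Graph.Vertex G → Fin t) → Set
IsDistinguishing G t f =
  (g : Automorphism G) → (∀ v → f (Automorphism.to g v) ≡ f v) → IsTrivial g

HasDistinguishingLabeling : Graph → ℕ → Set
HasDistinguishingLabeling G t = Σ (Graph.Vertex G → Fin t) (IsDistinguishing G t)

DistinguishingNumberIs : Graph → ℕ → Set
DistinguishingNumberIs G d =
  HasDistinguishingLabeling G d × (∀ t → HasDistinguishingLabeling G t → d ≤ t)

-- Vectors of F₂^n, written in coordinates w.r.t. the fixed basis b₁,…,bₙ
-- (true = coefficient 1, false = coefficient 0).
isNonZero : ∀ {n} → Vec Bool n → Bool
isNonZero []       = false
isNonZero (x ∷ xs) = x ∨ isNonZero xs

shareComponent : ∀ {n} → Vec Bool n → Vec Bool n → Bool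
shareComponent []       []       = false
shareComponent (x ∷ xs) (y ∷ ys) = (x ∧ y) ∨ shareComponent xs ys

-- Non-zero vectors (T is proof-irrelevant, so ≡ on these is ≡ of the vectors).
NonZeroVec : ℕ → Set
NonZeroVec n = Σ (Vec Bool n) (λ v → T (isNonZero v))

nonZeroComponentGraph : ℕ → Graph
nonZeroComponentGraph n = record
  { Vertex = NonZeroVec n
  ; Adj    = λ u v → ¬ (proj₁ u ≡ proj₁ v) × T (shareComponent (proj₁ u) (proj₁ v))
  }

module Submission where

-- An automorphism of G(V) preserves containment of supports, because u ⊆ v exactly when every
-- vertex meeting u also meets v; so it maps singletons to singletons and is the identity as soon
-- as it fixes every singleton. Label {0} and the pairs {i, i+1}. A label-preserving automorphism
-- fixes {0}, the only labelled singleton; once it fixes {i} and the labelled vertex {i-1, i}, it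
-- must fix {i, i+1}, the only other labelled vertex through i, and then {i+1}, the other singleton
-- below it. Swapping two coordinates is a non-trivial automorphism, so one label is not enough.

open import Defs
open import Data.Nat using (ℕ; zero; suc; _≤_; z≤n; s≤s)
open import Data.Nat.Properties using (<⇒≤; <⇒≱)
open import Data.Bool using (Bool; true; false; T)
open import Data.Bool.Properties using (T-∨; T-irrelevant; ∨-commutativeMonoid)
import Data.Bool as Bool
open import Data.Vec using (Vec; []; _∷_; here; there)
open import Data.Vec.Properties using (≡-dec)
open import Data.Fin using (Fin; zero; suc; inject₁; _<_)
import Data.Fin as Fin
open import Data.Fin.Properties
  using (inject₁-injective; ≤̄⇒inject₁<; ≤-refl; ≤-reflexive; <⇒≢; any?; ¬Fin0)
open import Data.Fin.Subset using (Subset; ⁅_⁆; _∪_; _∈_; _⊆_; Nonempty)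
open import Data.Fin.Induction using (<-weakInduction)
open import Data.Fin.Subset.Properties using (x∈⁅x⁆; x∈⁅y⁆⇒x≡y; ⊆-antisym; x∈p∪q⁺; x∈p∪q⁻)
open import Data.Product using (∃; _×_; _,_; proj₁; proj₂)
open import Data.Sum using (_⊎_; inj₁; inj₂)
open import Relation.Nullary using (¬_; Dec; yes; no; contradiction)
open import Relation.Binary.PropositionalEquality
open import Function using (_∘_)
open import Function.Bundles using (Equivalence; Inverse; mk↔ₛ′)
open import Algebra.Bundles using (CommutativeMonoid)
open import Algebra.Properties.CommutativeSemigroup
  (CommutativeMonoid.commutativeSemigroup ∨-commutativeMonoid) using (x∙yz≈y∙xz)

isNonZero-complete : ∀ {n} {x : Fin n} {p : Subset n} → x ∈ p → T (isNonZero p)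
isNonZero-complete {p = _ ∷ _} here      = _
isNonZero-complete {p = b ∷ _} (there m) = Equivalence.from (T-∨ {b}) (inj₂ (isNonZero-complete m))

isNonZero-sound : ∀ {n} (p : Subset n) → T (isNonZero p) → Nonempty p
isNonZero-sound []          ()
isNonZero-sound (true ∷ p)  _ = zero , here
isNonZero-sound (false ∷ p) t with isNonZero-sound p t
... | x , x∈p = suc x , there x∈p

shareComponent-complete : ∀ {n} {x : Fin n} {p q : Subset n} →
                          x ∈ p → x ∈ q → T (shareComponent p q)
shareComponent-complete {p = _ ∷ _} {_ ∷ _} here here = _
shareComponent-complete {p = a ∷ _} {b ∷ _} (there x∈p) (there x∈q) =
  Equivalence.from (T-∨ {a Bool.∧ b}) (inj₂ (shareComponent-complete x∈p x∈q))

shareComponent-sound : ∀ {n} (p q : Subset n) → T (shareComponent p q) → ∃ λ x → x ∈ p × x ∈ q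
shareComponent-sound []          []          ()
shareComponent-sound (true ∷ p)  (true ∷ q)  _ = zero , here , here
shareComponent-sound (true ∷ p)  (false ∷ q) t with shareComponent-sound p q t
... | x , x∈p , x∈q = suc x , there x∈p , there x∈q
shareComponent-sound (false ∷ p) (b ∷ q)     t with shareComponent-sound p q t
... | x , x∈p , x∈q = suc x , there x∈p , there x∈q

module _ {n : ℕ} where

  vertex-≡ : {u v : NonZeroVec n} → proj₁ u ≡ proj₁ v → u ≡ v
  vertex-≡ {u , s} {.u , t} refl = cong (u ,_) (T-irrelevant s t)

  ⁅_⁆ᵛ : Fin n → NonZeroVec n
  ⁅ x ⁆ᵛ = ⁅ x ⁆ , isNonZero-complete (x∈⁅x⁆ x)

  Meets : NonZeroVec n → NonZeroVec n → Set
  Meets u v = T (shareComponent (proj₁ u) (proj₁ v))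

  meets-refl : (v : NonZeroVec n) → Meets v v
  meets-refl (p , t) with isNonZero-sound p t
  ... | x , x∈p = shareComponent-complete x∈p x∈p

  infix 4 _⊑_
  _⊑_ : NonZeroVec n → NonZeroVec n → Set
  u ⊑ v = proj₁ u ⊆ proj₁ v

  ∈⇒⁅⁆ᵛ⊑ : ∀ {x} {v : NonZeroVec n} → x ∈ proj₁ v → ⁅ x ⁆ᵛ ⊑ v
  ∈⇒⁅⁆ᵛ⊑ {x} x∈v y∈⁅x⁆ = subst (_∈ _) (sym (x∈⁅y⁆⇒x≡y x y∈⁅x⁆)) x∈v

  ⁅⁆ᵛ⊑⇒∈ : ∀ {x} {v : NonZeroVec n} → ⁅ x ⁆ᵛ ⊑ v → x ∈ proj₁ v
  ⁅⁆ᵛ⊑⇒∈ {x} ⁅x⁆⊑v = ⁅x⁆⊑v (x∈⁅x⁆ x)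

  ⊑⁅⁆ᵛ⇒≡ : ∀ {x} {v : NonZeroVec n} → v ⊑ ⁅ x ⁆ᵛ → v ≡ ⁅ x ⁆ᵛ
  ⊑⁅⁆ᵛ⇒≡ {x} {v} v⊑⁅x⁆ with isNonZero-sound (proj₁ v) (proj₂ v)
  ... | y , y∈v = vertex-≡ (⊆-antisym v⊑⁅x⁆ (∈⇒⁅⁆ᵛ⊑ {v = v} x∈v))
    where x∈v = subst (_∈ proj₁ v) (x∈⁅y⁆⇒x≡y x (v⊑⁅x⁆ y∈v)) y∈v

  meets-monotone⇒⊑ : {u v : NonZeroVec n} → (∀ w → Meets w u → Meets w v) → u ⊑ v
  meets-monotone⇒⊑ {u} {v} h {x} x∈u with shareComponent-sound ⁅ x ⁆ (proj₁ v)
                                            (h ⁅ x ⁆ᵛ (shareComponent-complete (x∈⁅x⁆ x) x∈u))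
  ... | y , y∈⁅x⁆ , y∈v = subst (_∈ proj₁ v) (x∈⁅y⁆⇒x≡y x y∈⁅x⁆) y∈v

  ⊑⇒meets-monotone : {u v : NonZeroVec n} → u ⊑ v → ∀ w → Meets w u → Meets w v
  ⊑⇒meets-monotone {u} {v} u⊑v w m with shareComponent-sound (proj₁ w) (proj₁ u) m
  ... | x , x∈w , x∈u = shareComponent-complete x∈w (u⊑v x∈u)

module AutomorphismProperties {n : ℕ} (g : Automorphism (nonZeroComponentGraph n)) where
  open Automorphism g

  to-from : ∀ v → to (from v) ≡ v
  to-from = Inverse.strictlyInverseˡ perm

  to-injective : ∀ {u v} → to u ≡ to v → u ≡ v
  to-injective {u} {v} eq = begin
    u           ≡⟨ Inverse.strictlyInverseʳ perm u ⟨
    from (to u) ≡⟨ cong from eq ⟩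
    from (to v) ≡⟨ Inverse.strictlyInverseʳ perm v ⟩
    v           ∎
    where open ≡-Reasoning

  meets-preserved : ∀ u v → Meets u v → Meets (to u) (to v)
  meets-preserved u v m with ≡-dec Bool._≟_ (proj₁ u) (proj₁ v)
  ... | yes eq = subst (λ w → Meets (to u) (to w)) (vertex-≡ {u = u} {v} eq) (meets-refl (to u))
  ... | no  ne = proj₂ (adj-pres u v (ne , m))

  meets-reflected : ∀ u v → Meets (to u) (to v) → Meets u v
  meets-reflected u v m with ≡-dec Bool._≟_ (proj₁ u) (proj₁ v)
  ... | yes eq = subst (Meets u) (vertex-≡ {u = u} {v} eq) (meets-refl u)
  ... | no  ne = proj₂ (adj-refl u v ((λ eq → ne (cong proj₁ (to-injective (vertex-≡ eq)))) , m))

  ⊑-preserved : ∀ {u v} → u ⊑ v → to u ⊑ to v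
  ⊑-preserved {u} {v} u⊑v = meets-monotone⇒⊑ {u = to u} {to v} λ w m →
    subst (λ w → Meets w (to v)) (to-from w)
      (meets-preserved (from w) v (⊑⇒meets-monotone {u = u} {v} u⊑v (from w)
        (meets-reflected (from w) u (subst (λ w → Meets w (to u)) (sym (to-from w)) m))))

  ⊑-reflected : ∀ {u v} → to u ⊑ to v → u ⊑ v
  ⊑-reflected {u} {v} tu⊑tv = meets-monotone⇒⊑ {u = u} {v} λ w m →
    meets-reflected w v (⊑⇒meets-monotone {u = to u} {to v} tu⊑tv (to w) (meets-preserved w u m))

  singleton-image : ∀ x → ∃ λ y → to ⁅ x ⁆ᵛ ≡ ⁅ y ⁆ᵛ
  singleton-image x with isNonZero-sound (proj₁ (to ⁅ x ⁆ᵛ)) (proj₂ (to ⁅ x ⁆ᵛ))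
  ... | y , y∈tx = y , (begin
    to ⁅ x ⁆ᵛ          ≡⟨ cong to from⁅y⁆≡⁅x⁆ ⟨
    to (from ⁅ y ⁆ᵛ)   ≡⟨ to-from ⁅ y ⁆ᵛ ⟩
    ⁅ y ⁆ᵛ             ∎)
    where
    open ≡-Reasoning
    ⁅y⁆⊑tx : to (from ⁅ y ⁆ᵛ) ⊑ to ⁅ x ⁆ᵛ
    ⁅y⁆⊑tx = subst (_⊑ to ⁅ x ⁆ᵛ) (sym (to-from ⁅ y ⁆ᵛ)) (∈⇒⁅⁆ᵛ⊑ {v = to ⁅ x ⁆ᵛ} y∈tx)
    from⁅y⁆≡⁅x⁆ : from ⁅ y ⁆ᵛ ≡ ⁅ x ⁆ᵛ
    from⁅y⁆≡⁅x⁆ = ⊑⁅⁆ᵛ⇒≡ (⊑-reflected {from ⁅ y ⁆ᵛ} {⁅ x ⁆ᵛ} ⁅y⁆⊑tx)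

  fixing-singletons⇒trivial : (∀ x → to ⁅ x ⁆ᵛ ≡ ⁅ x ⁆ᵛ) → IsTrivial g
  fixing-singletons⇒trivial fixed v = vertex-≡ (⊆-antisym tv⊆v v⊆tv)
    where
    v⊆tv : proj₁ v ⊆ proj₁ (to v)
    v⊆tv {x} x∈v = ⁅⁆ᵛ⊑⇒∈ {v = to v}
      (subst (_⊑ to v) (fixed x) (⊑-preserved {⁅ x ⁆ᵛ} {v} (∈⇒⁅⁆ᵛ⊑ {v = v} x∈v)))
    tv⊆v : proj₁ (to v) ⊆ proj₁ v
    tv⊆v {x} x∈tv = ⁅⁆ᵛ⊑⇒∈ {v = v}
      (⊑-reflected {⁅ x ⁆ᵛ} {v} (subst (_⊑ to v) (sym (fixed x)) (∈⇒⁅⁆ᵛ⊑ {v = to v} x∈tv)))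

indicator : {P : Set} → Dec P → Fin 2
indicator (yes _) = suc zero
indicator (no _)  = zero

indicator-≡⇒ : {P Q : Set} (p : Dec P) (q : Dec Q) → indicator p ≡ indicator q → Q → P
indicator-≡⇒ (yes p) _      _  _ = p
indicator-≡⇒ (no _)  (yes _) () _
indicator-≡⇒ (no _)  (no ¬q) _  q = contradiction q ¬q

module PathLabeling (m : ℕ) where

  -- The labelled vertices are {0} and the consecutive pairs {i, i+1}; top x is the one with maximum x.
  top : Fin (suc m) → Subset (suc m)
  top zero    = ⁅ zero ⁆
  top (suc i) = ⁅ inject₁ i ⁆ ∪ ⁅ suc i ⁆

  x∈top[x] : ∀ x → x ∈ top x
  x∈top[x] zero    = x∈⁅x⁆ zero
  x∈top[x] (suc i) = x∈p∪q⁺ (inj₂ (x∈⁅x⁆ (suc i)))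

  inject₁<suc : ∀ (i : Fin m) → inject₁ i < suc i
  inject₁<suc i = ≤̄⇒inject₁< ≤-refl

  inject₁∈top[suc] : ∀ i → inject₁ i ∈ top (suc i)
  inject₁∈top[suc] i = x∈p∪q⁺ (inj₁ (x∈⁅x⁆ (inject₁ i)))

  ∈top[suc]⁻ : ∀ {i y} → y ∈ top (suc i) → y ≡ inject₁ i ⊎ y ≡ suc i
  ∈top[suc]⁻ {i} y∈top with x∈p∪q⁻ ⁅ inject₁ i ⁆ ⁅ suc i ⁆ y∈top
  ... | inj₁ y∈⁅i⁆  = inj₁ (x∈⁅y⁆⇒x≡y _ y∈⁅i⁆)
  ... | inj₂ y∈⁅i+1⁆ = inj₂ (x∈⁅y⁆⇒x≡y _ y∈⁅i+1⁆)

  ∈top⇒≤ : ∀ {x y} → y ∈ top x → y Fin.≤ x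
  ∈top⇒≤ {zero}  y∈top = ≤-reflexive (x∈⁅y⁆⇒x≡y zero y∈top)
  ∈top⇒≤ {suc i} y∈top with ∈top[suc]⁻ y∈top
  ... | inj₁ refl = <⇒≤ (inject₁<suc i)
  ... | inj₂ refl = ≤-refl

  inject₁∈top⁻ : ∀ {i x} → inject₁ i ∈ top x → x ≡ inject₁ i ⊎ x ≡ suc i
  inject₁∈top⁻ {i} {zero}  i∈top = inj₁ (sym (x∈⁅y⁆⇒x≡y zero i∈top))
  inject₁∈top⁻ {i} {suc j} i∈top with ∈top[suc]⁻ i∈top
  ... | inj₁ i≡j   = inj₂ (cong suc (sym (inject₁-injective i≡j)))
  ... | inj₂ i≡j+1 = inj₁ (sym i≡j+1)

  top[suc]≢⁅⁆ : ∀ i y → top (suc i) ≢ ⁅ y ⁆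
  top[suc]≢⁅⁆ i y eq = <⇒≢ (inject₁<suc i) (begin
    inject₁ i ≡⟨ x∈⁅y⁆⇒x≡y y (subst (inject₁ i ∈_) eq (inject₁∈top[suc] i)) ⟩
    y         ≡⟨ x∈⁅y⁆⇒x≡y y (subst (suc i ∈_) eq (x∈top[x] (suc i))) ⟨
    suc i     ∎)
    where open ≡-Reasoning

  topᵛ : Fin (suc m) → NonZeroVec (suc m)
  topᵛ x = top x , isNonZero-complete (x∈top[x] x)

  Labelled : NonZeroVec (suc m) → Set
  Labelled v = ∃ λ x → proj₁ v ≡ top x

  labelled? : ∀ v → Dec (Labelled v)
  labelled? v = any? λ x → ≡-dec Bool._≟_ (proj₁ v) (top x)

  label : NonZeroVec (suc m) → Fin 2
  label v = indicator (labelled? v)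

  module _ (g : Automorphism (nonZeroComponentGraph (suc m)))
           (labelled-preserved : ∀ v → Labelled v → Labelled (Automorphism.to g v)) where
    open Automorphism g
    open AutomorphismProperties g

    ⊑-image : ∀ {u v u′ v′} → u ⊑ v → to u ≡ u′ → to v ≡ v′ → u′ ⊑ v′
    ⊑-image {u} {v} u⊑v refl refl = ⊑-preserved {u} {v} u⊑v

    Fixed : Fin (suc m) → Set
    Fixed x = to ⁅ x ⁆ᵛ ≡ ⁅ x ⁆ᵛ × to (topᵛ x) ≡ topᵛ x

    top-image : ∀ x → ∃ λ z → to (topᵛ x) ≡ topᵛ z
    top-image x with labelled-preserved (topᵛ x) (x , refl)
    ... | z , eq = z , vertex-≡ eq

    zero-fixed : Fixed zero
    zero-fixed with top-image zero
    ... | zero  , eq = eq , eq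
    ... | suc i , eq with singleton-image zero
    ...   | y , eq′ = contradiction (cong proj₁ (trans (sym eq) eq′)) (top[suc]≢⁅⁆ i y)

    top[suc]-fixed : ∀ i → Fixed (inject₁ i) → to (topᵛ (suc i)) ≡ topᵛ (suc i)
    top[suc]-fixed i (⁅i⁆-fixed , top[i]-fixed) with top-image (suc i)
    ... | z , eq with inject₁∈top⁻ {i} {z} (⁅⁆ᵛ⊑⇒∈ {v = topᵛ z}
                    (⊑-image {⁅ inject₁ i ⁆ᵛ} {topᵛ (suc i)}
                      (∈⇒⁅⁆ᵛ⊑ {x = inject₁ i} {topᵛ (suc i)} (inject₁∈top[suc] i)) ⁅i⁆-fixed eq))
    ... | inj₂ refl = eq
    ... | inj₁ refl = contradiction
                        (∈top⇒≤ (subst (suc i ∈_) top[suc]≡top[i] (x∈top[x] (suc i))))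
                        (<⇒≱ (inject₁<suc i))
      where
      top[suc]≡top[i] : top (suc i) ≡ top (inject₁ i)
      top[suc]≡top[i] = cong proj₁ (to-injective (trans eq (sym top[i]-fixed)))

    suc-fixed : ∀ i → Fixed (inject₁ i) → Fixed (suc i)
    suc-fixed i fixed@(⁅i⁆-fixed , _) with singleton-image (suc i)
    ... | y , eq with ∈top[suc]⁻ (⁅⁆ᵛ⊑⇒∈ {v = topᵛ (suc i)}
                        (⊑-image {⁅ suc i ⁆ᵛ} {topᵛ (suc i)}
                          (∈⇒⁅⁆ᵛ⊑ {x = suc i} {topᵛ (suc i)} (x∈top[x] (suc i)))
                          eq (top[suc]-fixed i fixed)))
    ... | inj₂ refl = eq , top[suc]-fixed i fixed
    ... | inj₁ refl = contradiction
                        (sym (x∈⁅y⁆⇒x≡y (inject₁ i) (subst (suc i ∈_) ⁅suc⁆≡⁅i⁆ (x∈⁅x⁆ (suc i)))))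
                        (<⇒≢ (inject₁<suc i))
      where
      ⁅suc⁆≡⁅i⁆ : ⁅ suc i ⁆ ≡ ⁅ inject₁ i ⁆
      ⁅suc⁆≡⁅i⁆ = cong proj₁ (to-injective (trans eq (sym ⁅i⁆-fixed)))

    label-preserving⇒trivial : IsTrivial g
    label-preserving⇒trivial =
      fixing-singletons⇒trivial (proj₁ ∘ <-weakInduction Fixed zero-fixed suc-fixed)

  label-distinguishing : IsDistinguishing (nonZeroComponentGraph (suc m)) 2 label
  label-distinguishing g same-label = label-preserving⇒trivial g λ v →
    indicator-≡⇒ (labelled? (Automorphism.to g v)) (labelled? v) (same-label v)

nontrivial-automorphism⇒2≤ : ∀ {G t} (g : Automorphism G) → ¬ IsTrivial g →
                             HasDistinguishingLabeling G t → 2 ≤ t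
nontrivial-automorphism⇒2≤ {t = zero}        g nontrivial (f , _) =
  contradiction (λ v → contradiction (f v) ¬Fin0) nontrivial
nontrivial-automorphism⇒2≤ {t = suc zero}    g nontrivial (f , distinguishing) =
  contradiction (distinguishing g λ v → Fin1-unique (f (Automorphism.to g v)) (f v)) nontrivial
  where
  Fin1-unique : (i j : Fin 1) → i ≡ j
  Fin1-unique zero zero = refl
nontrivial-automorphism⇒2≤ {t = suc (suc t)} _ _ _ = s≤s (s≤s z≤n)

module SwapFirstTwo (m : ℕ) where

  swap : Vec Bool (suc (suc m)) → Vec Bool (suc (suc m))
  swap (a ∷ b ∷ p) = b ∷ a ∷ p

  swap-involutive : ∀ p → swap (swap p) ≡ p
  swap-involutive (a ∷ b ∷ p) = refl

  isNonZero-swap : ∀ p → isNonZero (swap p) ≡ isNonZero p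
  isNonZero-swap (a ∷ b ∷ p) = x∙yz≈y∙xz b a (isNonZero p)

  shareComponent-swap : ∀ p q → shareComponent (swap p) (swap q) ≡ shareComponent p q
  shareComponent-swap (a ∷ b ∷ p) (c ∷ d ∷ q) = x∙yz≈y∙xz (b Bool.∧ d) (a Bool.∧ c) (shareComponent p q)

  swap-injective : ∀ {p q} → swap p ≡ swap q → p ≡ q
  swap-injective {p} {q} eq = begin
    p               ≡⟨ swap-involutive p ⟨
    swap (swap p)   ≡⟨ cong swap eq ⟩
    swap (swap q)   ≡⟨ swap-involutive q ⟩
    q               ∎
    where open ≡-Reasoning

  swapᵛ : NonZeroVec (suc (suc m)) → NonZeroVec (suc (suc m))
  swapᵛ (p , t) = swap p , subst T (sym (isNonZero-swap p)) t

  swapᵛ-involutive : ∀ v → swapᵛ (swapᵛ v) ≡ v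
  swapᵛ-involutive (p , _) = vertex-≡ (swap-involutive p)

  swap-automorphism : Automorphism (nonZeroComponentGraph (suc (suc m)))
  swap-automorphism = record
    { perm     = mk↔ₛ′ swapᵛ swapᵛ swapᵛ-involutive swapᵛ-involutive
    ; adj-pres = λ u v (u≢v , meets) →
        (u≢v ∘ swap-injective)
        , subst T (sym (shareComponent-swap (proj₁ u) (proj₁ v))) meets
    ; adj-refl = λ u v (u≢v , meets) →
        (u≢v ∘ cong swap) , subst T (shareComponent-swap (proj₁ u) (proj₁ v)) meets
    }

  swap-nontrivial : ¬ IsTrivial swap-automorphism
  swap-nontrivial trivial with cong proj₁ (trivial ⁅ zero ⁆ᵛ)
  ... | ()

mainTheorem8 : (n : ℕ) → 3 ≤ n → DistinguishingNumberIs (nonZeroComponentGraph n) 2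
mainTheorem8 zero          ()
mainTheorem8 (suc zero)    (s≤s ())
mainTheorem8 (suc (suc m)) _ =
    (label , label-distinguishing)
  , λ t → nontrivial-automorphism⇒2≤ swap-automorphism swap-nontrivial
  where
  open PathLabeling (suc m)
  open SwapFirstTwo m
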